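{- Let $r\ge 2$ and $k\ge 2$ be integers, let $H=(V,\mathcal{E})$ be an $r$-uniform hypergraph, and let $c$ be a $k$-coloring that is a Nash equilibrium of the game in which all vertices are conflict-free seeking. For $e\in\mathcal{E}$ let $j(e)=|\{v\in e: c(e\setminus\{v\})=c(e)\}|$ be the number of vertices of $e$ whose color is not unique in $e$, and let $\hat j=\sum_{e\in\mathcal{E}}j(e)$. Then (1) $\hat j\le \dfrac{|\mathcal{E}|\,r(r-1)}{\frac{r}{2}+k-1}$; (2) $SW(c)\ge |\mathcal{E}|\,r\,\dfrac{2k-r}{2k+r-2}$.
   Context: A hypergraph is a pair $H=(V,\mathcal{E})$ with $V$ a finite set and $\mathcal{E}$ a collection of non-empty subsets of $V$; it is $r$-uniform if every hyperedge has exactly $r$ elements. A $k$-coloring is a function $c:V\to[k]=\{1,\dots,k\}$; for $S\subseteq V$, $c(S)$ is the set of colors used on $S$. $\mathcal{E}(v)=\{e\in\mathcal{E}: v\in e\}$. A conflict-free seeking vertex $v$ has utility $u_v(c)=|\{e\in\mathcal{E}(v): |c(e)|=|c(e\setminus\{v\})|+1\}|$, and $SW(c)=\sum_{v\in V}u_v(c)$. A coloring $c$ is a Nash equilibrium if no vertex $v$ can strictly increase $u_v$ by changing only its own color to some $i\in[k]$. -}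

module Defs where

open import Data.Nat using (ℕ; suc; _<_)
open import Data.Nat.Properties using () renaming (_≟_ to _≟ℕ_)
open import Data.Bool using (Bool; if_then_else_)
open import Data.Bool.Properties using () renaming (_≟_ to _≟B_)
open import Data.Fin using (Fin; _≟_)
open import Data.Fin.Properties using (any?)
open import Data.Fin.Subset using (Subset; _∈_; ∣_∣; outside)
open import Data.Fin.Subset.Properties using (_∈?_)
open import Data.Vec using (tabulate; _[_]≔_)
open import Data.Vec.Properties using (≡-dec)
open import Data.List using (List; length; filter; map; allFin)
open import Data.Nat.ListAction using (sum)
open import Data.List.Relation.Unary.All using (All)
open import Data.List.Relation.Unary.Unique.Propositional using (Unique)
open import Data.Product using (_×_)
open import Relation.Nullary using (¬_; does)
open import Relation.Nullary.Decidable using (_×-dec_)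
open import Relation.Binary.PropositionalEquality using (_≡_)

record Hypergraph (n : ℕ) : Set where
  constructor hypergraph
  field
    edges    : List (Subset n)
    distinct : Unique edges

open Hypergraph public

Uniform : ∀ {n} → ℕ → Hypergraph n → Set
Uniform r H = All (λ e → ∣ e ∣ ≡ r) (edges H)

Coloring : ℕ → ℕ → Set
Coloring n k = Fin n → Fin k

colors : ∀ {n k} → Coloring n k → Subset n → Subset k
colors c S = tabulate λ i → does (any? (λ w → (w ∈? S) ×-dec (c w ≟ i)))

remove : ∀ {n} → Fin n → Subset n → Subset n
remove v S = S [ v ]≔ outside

utility : ∀ {n k} → Hypergraph n → Coloring n k → Fin n → ℕ
utility H c v =
  length (filter (λ e → (v ∈? e) ×-dec (∣ colors c e ∣ ≟ℕ suc ∣ colors c (remove v e) ∣))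
                 (edges H))

SW : ∀ {n k} → Hypergraph n → Coloring n k → ℕ
SW {n} H c = sum (map (utility H c) (allFin n))

recolor : ∀ {n k} → Coloring n k → Fin n → Fin k → Coloring n k
recolor c v i w = if does (w ≟ v) then i else c w

NashEquilibrium : ∀ {n k} → Hypergraph n → Coloring n k → Set
NashEquilibrium {n} {k} H c =
  (v : Fin n) (i : Fin k) → ¬ (utility H c v < utility H (recolor c v i) v)

jEdge : ∀ {n k} → Coloring n k → Subset n → ℕ
jEdge {n} c e =
  length (filter (λ v → (v ∈? e) ×-dec ≡-dec _≟B_ (colors c (remove v e)) (colors c e))
                 (allFin n))

jHat : ∀ {n k} → Hypergraph n → Coloring n k → ℕ
jHat H c = sum (map (jEdge c) (edges H))

-- Write x_v(e) for the number of other vertices of e that share v's colour: v gains from e iff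
-- x_v(e) = 0, and v counts towards j(e) iff x_v(e) > 0.  Were v to switch to colour i, it would gain
-- from exactly those e ∋ v in which i is absent from e∖{v}; at a Nash equilibrium each of these k
-- counts is at most u_v, and summing them over i gives k (deg v − u_v) ≤ Σ_{e∋v} |c(e∖{v})|.  Summed
-- over v this is k ĵ ≤ Σ_e Σ_{v∈e} |c(e∖{v})|.  Inside one edge with C colours and U uniquely
-- coloured vertices, Σ_{v∈e} |c(e∖{v})| = rC − U, 2C ≤ r + U and U + j(e) = r.  Summing over the
-- edges and eliminating C and U gives (1); since SW = Σ_e U = |E| r − ĵ, (1) gives (2).

module Submission where

open import Defs
open import Data.Nat using (ℕ; _≤_; _*_; _+_; _∸_)
open import Data.Integer using (+_) renaming (_≤_ to _≤ℤ_; _*_ to _*ℤ_; _-_ to _-ℤ_; _+_ to _+ℤ_)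
open import Data.List using (length)
open import Data.Product using (_×_)

open import Data.Nat using (zero; suc; pred; _<_; z≤n; s≤s)
open import Data.Nat.Properties hiding (_≟_)
open import Data.Nat.Properties using () renaming (_≟_ to _≟ℕ_)
open import Data.Nat.Tactic.RingSolver using (solve)
open import Data.Nat.ListAction using (sum)
import Data.Integer as ℤ
import Data.Integer.Properties as ℤ
import Data.Integer.Tactic.RingSolver as ℤ
open import Data.Bool using (Bool; true; false)
open import Data.Bool.Properties using () renaming (_≟_ to _≟B_)
open import Data.Fin using (Fin; zero; suc; _≟_)
open import Data.Fin.Properties using (any?)
open import Data.Fin.Subset using (Subset; _∈_; ∣_∣; outside)
open import Data.Fin.Subset.Properties using (_∈?_)
open import Data.Vec using (lookup)
import Data.Vec as Vec
open import Data.Vec.Properties using (≡-dec; lookup∘tabulate; tabulate-cong; lookup∘update; lookup∘update′)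
open import Data.List using (List; []; _∷_; map; filter; allFin)
import Data.List as List
open import Data.List.Membership.Propositional.Properties using (∈-lookup)
import Data.List.Relation.Unary.All as All
open import Data.Product using (_,_)
open import Relation.Nullary using (Dec; yes; no; does; ¬_; contradiction)
open import Relation.Nullary.Decidable using (_×-dec_)
open import Relation.Unary using (Pred; Decidable)
open import Relation.Binary.PropositionalEquality
  using (_≡_; _≢_; refl; sym; trans; cong; cong₂; subst; subst₂; module ≡-Reasoning)
open import Algebra.Properties.Semiring.Sum +-*-semiring
  using (sum-syntax; ∑-distrib-+; ∑-comm; *-distribˡ-sum; *-distribʳ-sum; sum-cong-≗; sum-replicate-zero)
  renaming (sum to ∑)

𝟙 : Bool → ℕ
𝟙 false = 0
𝟙 true  = 1

[_] : ∀ {a} {A : Set a} → Dec A → ℕ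
[ d ] = 𝟙 (does d)

[_>0] : ℕ → ℕ
[ zero  >0] = 0
[ suc _ >0] = 1

[_≡0] : ℕ → ℕ
[ zero  ≡0] = 1
[ suc _ ≡0] = 0

[]-yes : ∀ {a} {A : Set a} (d : Dec A) → A → [ d ] ≡ 1
[]-yes (yes _) _ = refl
[]-yes (no ¬a) a = contradiction a ¬a

[]-no : ∀ {a} {A : Set a} (d : Dec A) → ¬ A → [ d ] ≡ 0
[]-no (yes a) ¬a = contradiction a ¬a
[]-no (no _)  _  = refl

[]-×-dec : ∀ {a b} {A : Set a} {B : Set b} (p : Dec A) (q : Dec B) → [ p ×-dec q ] ≡ [ p ] * [ q ]
[]-×-dec (yes _) q = sym (+-identityʳ [ q ])
[]-×-dec (no _)  q = refl

[]*-cong : ∀ {a} {A : Set a} (d : Dec A) {x y : ℕ} → (A → x ≡ y) → [ d ] * x ≡ [ d ] * y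
[]*-cong (yes a) x≡y = cong (_+ 0) (x≡y a)
[]*-cong (no _)  _   = refl

𝟙-injective : ∀ {x y} → 𝟙 x ≡ 𝟙 y → x ≡ y
𝟙-injective {false} {false} _ = refl
𝟙-injective {true}  {true}  _ = refl

[≡0]+[>0] : ∀ m → [ m ≡0] + [ m >0] ≡ 1
[≡0]+[>0] zero    = refl
[≡0]+[>0] (suc _) = refl

[+𝟙>0] : ∀ m b → [ m + 𝟙 b >0] ≡ [ m >0] + 𝟙 b * [ m ≡0]
[+𝟙>0] zero    false = refl
[+𝟙>0] zero    true  = refl
[+𝟙>0] (suc m) false = refl
[+𝟙>0] (suc m) true  = refl

[+[≡0]≟suc] : ∀ m x → [ m + [ x ≡0] ≟ℕ suc m ] ≡ [ x ≡0]
[+[≡0]≟suc] m zero    = []-yes (m + 1 ≟ℕ suc m) (+-comm m 1)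
[+[≡0]≟suc] m (suc _) = []-no (m + 0 ≟ℕ suc m) (λ eq → 1+n≢n (sym (trans (sym (+-identityʳ m)) eq)))

∑-mono-≤ : ∀ {n} {f g : Fin n → ℕ} → (∀ i → f i ≤ g i) → ∑ f ≤ ∑ g
∑-mono-≤ {zero}  f≤g = z≤n
∑-mono-≤ {suc n} f≤g = +-mono-≤ (f≤g zero) (∑-mono-≤ (λ i → f≤g (suc i)))

∑-const : ∀ n x → ∑[ i < n ] x ≡ n * x
∑-const zero    x = refl
∑-const (suc n) x = cong (_+_ x) (∑-const n x)

∑-δ : ∀ {n} (j : Fin n) (f : Fin n → ℕ) → ∑[ i < n ] ([ j ≟ i ] * f i) ≡ f j
∑-δ {suc n} zero    f = trans (cong₂ _+_ (+-identityʳ (f zero)) (sum-replicate-zero n)) (+-identityʳ _)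
∑-δ {suc n} (suc j) f = ∑-δ j (λ i → f (suc i))

∑-fibres : ∀ {n k} (c : Fin n → Fin k) (g : Fin n → ℕ) (f : Fin k → ℕ) →
           ∑[ w < n ] (g w * f (c w)) ≡ ∑[ i < k ] ((∑[ w < n ] (g w * [ c w ≟ i ])) * f i)
∑-fibres {n} {k} c g f = begin
  ∑[ w < n ] (g w * f (c w))                             ≡⟨ sum-cong-≗ (λ w → cong (g w *_) (∑-δ (c w) f)) ⟨
  ∑[ w < n ] (g w * ∑[ i < k ] ([ c w ≟ i ] * f i))      ≡⟨ sum-cong-≗ (λ w → *-distribˡ-sum (g w) (λ i → [ c w ≟ i ] * f i)) ⟩
  ∑[ w < n ] ∑[ i < k ] (g w * ([ c w ≟ i ] * f i))      ≡⟨ ∑-comm (λ w i → g w * ([ c w ≟ i ] * f i)) ⟩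
  ∑[ i < k ] ∑[ w < n ] (g w * ([ c w ≟ i ] * f i))      ≡⟨ sum-cong-≗ (λ i → sum-cong-≗ (λ w → *-assoc (g w) [ c w ≟ i ] (f i))) ⟨
  ∑[ i < k ] ∑[ w < n ] (g w * [ c w ≟ i ] * f i)        ≡⟨ sum-cong-≗ (λ i → *-distribʳ-sum (f i) (λ w → g w * [ c w ≟ i ])) ⟨
  ∑[ i < k ] ((∑[ w < n ] (g w * [ c w ≟ i ])) * f i)   ∎
  where open ≡-Reasoning

length-filter≡sum : ∀ {a p} {A : Set a} {P : Pred A p} (P? : Decidable P) (xs : List A) →
                    length (filter P? xs) ≡ sum (map (λ x → [ P? x ]) xs)
length-filter≡sum P? []       = refl
length-filter≡sum P? (x ∷ xs) with does (P? x)
... | true  = cong suc (length-filter≡sum P? xs)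
... | false = length-filter≡sum P? xs

sum-map-lookup : ∀ {a} {A : Set a} (f : A → ℕ) (xs : List A) →
                 sum (map f xs) ≡ ∑[ t < length xs ] f (List.lookup xs t)
sum-map-lookup f []       = refl
sum-map-lookup f (x ∷ xs) = cong (_+_ (f x)) (sum-map-lookup f xs)

sum-map-tabulate : ∀ {a} {A : Set a} {n} (f : A → ℕ) (g : Fin n → A) →
                   sum (map f (List.tabulate g)) ≡ ∑[ i < n ] f (g i)
sum-map-tabulate {n = zero}  f g = refl
sum-map-tabulate {n = suc n} f g = cong (_+_ (f (g zero))) (sum-map-tabulate f (λ i → g (suc i)))

[∈?]≡𝟙-lookup : ∀ {n} (w : Fin n) (S : Subset n) → [ w ∈? S ] ≡ 𝟙 (lookup S w)
[∈?]≡𝟙-lookup zero    (true  Vec.∷ S) = refl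
[∈?]≡𝟙-lookup zero    (false Vec.∷ S) = refl
[∈?]≡𝟙-lookup (suc w) (_ Vec.∷ S) = [∈?]≡𝟙-lookup w S

∣∣≡∑∈ : ∀ {n} (S : Subset n) → ∣ S ∣ ≡ ∑[ w < n ] [ w ∈? S ]
∣∣≡∑∈ Vec.[]          = refl
∣∣≡∑∈ (true  Vec.∷ S) = cong suc (∣∣≡∑∈ S)
∣∣≡∑∈ (false Vec.∷ S) = ∣∣≡∑∈ S

[∈?remove-self] : ∀ {n} (v : Fin n) (S : Subset n) → [ v ∈? remove v S ] ≡ 0
[∈?remove-self] v S = trans ([∈?]≡𝟙-lookup v (remove v S)) (cong 𝟙 (lookup∘update v S outside))

[∈?]-remove : ∀ {n} {v : Fin n} {S : Subset n} → v ∈ S → ∀ w → [ w ∈? S ] ≡ [ w ∈? remove v S ] + [ v ≟ w ]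
[∈?]-remove {v = v} {S} v∈S w with v ≟ w
... | yes refl = trans ([]-yes (v ∈? S) v∈S) (cong (_+ 1) (sym ([∈?remove-self] v S)))
... | no v≢w   = begin
  [ w ∈? S ]                   ≡⟨ [∈?]≡𝟙-lookup w S ⟩
  𝟙 (lookup S w)               ≡⟨ cong 𝟙 (lookup∘update′ (λ w≡v → v≢w (sym w≡v)) S outside) ⟨
  𝟙 (lookup (remove v S) w)    ≡⟨ [∈?]≡𝟙-lookup w (remove v S) ⟨
  [ w ∈? remove v S ]          ≡⟨ +-identityʳ _ ⟨
  [ w ∈? remove v S ] + 0      ∎
  where open ≡-Reasoning

count : ∀ {n k} → Coloring n k → Subset n → Fin k → ℕ
count {n} c S i = ∑[ w < n ] ([ w ∈? S ] * [ c w ≟ i ])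

count-remove : ∀ {n k} (c : Coloring n k) {v S} → v ∈ S → ∀ i →
               count c S i ≡ count c (remove v S) i + [ c v ≟ i ]
count-remove {n} c {v} {S} v∈S i = begin
  ∑[ w < n ] ([ w ∈? S ] * [ c w ≟ i ])
    ≡⟨ sum-cong-≗ (λ w → cong (_* [ c w ≟ i ]) ([∈?]-remove v∈S w)) ⟩
  ∑[ w < n ] (([ w ∈? remove v S ] + [ v ≟ w ]) * [ c w ≟ i ])
    ≡⟨ sum-cong-≗ (λ w → *-distribʳ-+ [ c w ≟ i ] [ w ∈? remove v S ] [ v ≟ w ]) ⟩
  ∑[ w < n ] ([ w ∈? remove v S ] * [ c w ≟ i ] + [ v ≟ w ] * [ c w ≟ i ])
    ≡⟨ ∑-distrib-+ (λ w → [ w ∈? remove v S ] * [ c w ≟ i ]) (λ w → [ v ≟ w ] * [ c w ≟ i ]) ⟩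
  count c (remove v S) i + ∑[ w < n ] ([ v ≟ w ] * [ c w ≟ i ])
    ≡⟨ cong (_+_ (count c (remove v S) i)) (∑-δ v (λ w → [ c w ≟ i ])) ⟩
  count c (remove v S) i + [ c v ≟ i ]
    ∎
  where open ≡-Reasoning

sameColour : ∀ {n k} → Coloring n k → Fin n → Subset n → ℕ
sameColour c v S = count c (remove v S) (c v)

count-own-colour : ∀ {n k} (c : Coloring n k) {v S} → v ∈ S → count c S (c v) ≡ suc (sameColour c v S)
count-own-colour c {v} v∈S =
  trans (count-remove c v∈S (c v)) (trans (cong (_+_ (sameColour c v _)) ([]-yes (c v ≟ c v) refl)) (+-comm _ 1))

𝟙-any? : ∀ {n p} {P : Pred (Fin n) p} (P? : Decidable P) → 𝟙 (does (any? P?)) ≡ [ ∑[ w < n ] [ P? w ] >0]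
𝟙-any? {zero}  P? = refl
𝟙-any? {suc n} P? with does (P? zero)
... | true  = refl
... | false = 𝟙-any? (λ w → P? (suc w))

𝟙-colour-used : ∀ {n k} (c : Coloring n k) S i → 𝟙 (does (any? (λ w → (w ∈? S) ×-dec (c w ≟ i)))) ≡ [ count c S i >0]
𝟙-colour-used c S i =
  trans (𝟙-any? (λ w → (w ∈? S) ×-dec (c w ≟ i))) (cong [_>0] (sum-cong-≗ (λ w → []-×-dec (w ∈? S) (c w ≟ i))))

𝟙-lookup-colors : ∀ {n k} (c : Coloring n k) S i → 𝟙 (lookup (colors c S) i) ≡ [ count c S i >0]
𝟙-lookup-colors c S i = trans (cong 𝟙 (lookup∘tabulate _ i)) (𝟙-colour-used c S i)

∣colors∣ : ∀ {n k} (c : Coloring n k) S → ∣ colors c S ∣ ≡ ∑[ i < k ] [ count c S i >0]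
∣colors∣ c S = trans (∣∣≡∑∈ (colors c S)) (sum-cong-≗ (λ i → trans ([∈?]≡𝟙-lookup i (colors c S)) (𝟙-lookup-colors c S i)))

absent+∣colors∣ : ∀ {n k} (c : Coloring n k) S → ∑[ i < k ] [ count c S i ≡0] + ∣ colors c S ∣ ≡ k
absent+∣colors∣ {k = k} c S = begin
  ∑[ i < k ] [ count c S i ≡0] + ∣ colors c S ∣                   ≡⟨ cong (_+_ _) (∣colors∣ c S) ⟩
  ∑[ i < k ] [ count c S i ≡0] + ∑[ i < k ] [ count c S i >0]    ≡⟨ ∑-distrib-+ (λ i → [ count c S i ≡0]) (λ i → [ count c S i >0]) ⟨
  ∑[ i < k ] ([ count c S i ≡0] + [ count c S i >0])              ≡⟨ sum-cong-≗ (λ i → [≡0]+[>0] (count c S i)) ⟩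
  ∑[ i < k ] 1                                                    ≡⟨ ∑-const k 1 ⟩
  k * 1                                                           ≡⟨ *-identityʳ k ⟩
  k                                                               ∎
  where open ≡-Reasoning

∣colors∣-remove : ∀ {n k} (c : Coloring n k) {v S} → v ∈ S →
                  ∣ colors c S ∣ ≡ ∣ colors c (remove v S) ∣ + [ sameColour c v S ≡0]
∣colors∣-remove {k = k} c {v} {S} v∈S = begin
  ∣ colors c S ∣
    ≡⟨ ∣colors∣ c S ⟩
  ∑[ i < k ] [ count c S i >0]
    ≡⟨ sum-cong-≗ (λ i → cong [_>0] (count-remove c v∈S i)) ⟩
  ∑[ i < k ] [ m i + [ c v ≟ i ] >0]
    ≡⟨ sum-cong-≗ (λ i → [+𝟙>0] (m i) (does (c v ≟ i))) ⟩
  ∑[ i < k ] ([ m i >0] + [ c v ≟ i ] * [ m i ≡0])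
    ≡⟨ ∑-distrib-+ (λ i → [ m i >0]) (λ i → [ c v ≟ i ] * [ m i ≡0]) ⟩
  ∑[ i < k ] [ m i >0] + ∑[ i < k ] ([ c v ≟ i ] * [ m i ≡0])
    ≡⟨ cong₂ _+_ (∣colors∣ c (remove v S)) (sym (∑-δ (c v) (λ i → [ m i ≡0]))) ⟨
  ∣ colors c (remove v S) ∣ + [ sameColour c v S ≡0]
    ∎
  where
  open ≡-Reasoning
  m : Fin k → ℕ
  m = count c (remove v S)

[+>0] : ∀ {x} b → 0 < x → [ x + b >0] ≡ [ x >0]
[+>0] b (s≤s _) = refl

[count-remove>0] : ∀ {n k} (c : Coloring n k) {v S} → v ∈ S → 0 < sameColour c v S → ∀ i →
                   [ count c S i >0] ≡ [ count c (remove v S) i >0]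
[count-remove>0] c {v} v∈S shared i with c v ≟ i | count-remove c v∈S i
... | no _     | eq = cong [_>0] (trans eq (+-identityʳ _))
... | yes refl | eq = trans (cong [_>0] eq) ([+>0] 1 shared)

colors-remove : ∀ {n k} (c : Coloring n k) {v S} → v ∈ S → 0 < sameColour c v S →
                colors c (remove v S) ≡ colors c S
colors-remove c {v} {S} v∈S shared = tabulate-cong λ i → 𝟙-injective (begin
  𝟙 (does (any? (λ w → (w ∈? remove v S) ×-dec (c w ≟ i))))  ≡⟨ 𝟙-colour-used c (remove v S) i ⟩
  [ count c (remove v S) i >0]                                ≡⟨ [count-remove>0] c v∈S shared i ⟨
  [ count c S i >0]                                           ≡⟨ 𝟙-colour-used c S i ⟨
  𝟙 (does (any? (λ w → (w ∈? S) ×-dec (c w ≟ i))))           ∎)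
  where open ≡-Reasoning

[colors-remove≟colors] : ∀ {n k} (c : Coloring n k) {v S} → v ∈ S →
                         [ ≡-dec _≟B_ (colors c (remove v S)) (colors c S) ] ≡ [ sameColour c v S >0]
[colors-remove≟colors] c {v} {S} v∈S with sameColour c v S in eq
... | zero  = []-no (≡-dec _≟B_ (colors c (remove v S)) (colors c S)) λ same →
  m+1+n≢m ∣ colors c (remove v S) ∣
    (sym (trans (cong ∣_∣ same) (trans (∣colors∣-remove c v∈S) (cong (λ x → ∣ colors c (remove v S) ∣ + [ x ≡0]) eq))))
... | suc _ = []-yes (≡-dec _≟B_ (colors c (remove v S)) (colors c S))
  (colors-remove c v∈S (subst (0 <_) (sym eq) (s≤s z≤n)))

[∣colors∣≟suc] : ∀ {n k} (c : Coloring n k) {v S} → v ∈ S →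
                 [ ∣ colors c S ∣ ≟ℕ suc ∣ colors c (remove v S) ∣ ] ≡ [ sameColour c v S ≡0]
[∣colors∣≟suc] c {v} {S} v∈S =
  trans (cong (λ x → [ x ≟ℕ suc ∣ colors c (remove v S) ∣ ]) (∣colors∣-remove c v∈S))
        ([+[≡0]≟suc] ∣ colors c (remove v S) ∣ (sameColour c v S))

remove-∌ : ∀ {n} (v : Fin n) S → ¬ (v ∈ remove v S)
remove-∌ v S v∈ = 1+n≢n (trans (sym ([]-yes (v ∈? remove v S) v∈)) ([∈?remove-self] v S))

recolor-self : ∀ {n k} (c : Coloring n k) v i → recolor c v i v ≡ i
recolor-self c v i with v ≟ v
... | yes _   = refl
... | no v≢v = contradiction refl v≢v

recolor-other : ∀ {n k} (c : Coloring n k) v i {w} → w ≢ v → recolor c v i w ≡ c w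
recolor-other c v i {w} w≢v with w ≟ v
... | yes w≡v = contradiction w≡v w≢v
... | no _    = refl

count-recolor-remove : ∀ {n k} (c : Coloring n k) v i S j →
                       count (recolor c v i) (remove v S) j ≡ count c (remove v S) j
count-recolor-remove c v i S j = sum-cong-≗ λ w → []*-cong (w ∈? remove v S) λ w∈ →
  cong (λ x → [ x ≟ j ]) (recolor-other c v i λ { refl → remove-∌ v S w∈ })

∑ₑ : ∀ {n} → Hypergraph n → (Subset n → ℕ) → ℕ
∑ₑ H f = ∑[ t < length (edges H) ] f (List.lookup (edges H) t)

module _ {n} (H : Hypergraph n) where

  ∑ₑ-cong : ∀ {f g : Subset n → ℕ} → (∀ e → f e ≡ g e) → ∑ₑ H f ≡ ∑ₑ H g
  ∑ₑ-cong f≡g = sum-cong-≗ (λ t → f≡g (List.lookup (edges H) t))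

  ∑ₑ-mono-≤ : ∀ {f g : Subset n → ℕ} → (∀ e → f e ≤ g e) → ∑ₑ H f ≤ ∑ₑ H g
  ∑ₑ-mono-≤ f≤g = ∑-mono-≤ (λ t → f≤g (List.lookup (edges H) t))

  ∑ₑ-distrib-+ : ∀ (f g : Subset n → ℕ) → ∑ₑ H (λ e → f e + g e) ≡ ∑ₑ H f + ∑ₑ H g
  ∑ₑ-distrib-+ f g = ∑-distrib-+ (λ t → f (List.lookup (edges H) t)) (λ t → g (List.lookup (edges H) t))

  *-distribˡ-∑ₑ : ∀ x (f : Subset n → ℕ) → x * ∑ₑ H f ≡ ∑ₑ H (λ e → x * f e)
  *-distribˡ-∑ₑ x f = *-distribˡ-sum x (λ t → f (List.lookup (edges H) t))

  *-distribʳ-∑ₑ : ∀ x (f : Subset n → ℕ) → ∑ₑ H f * x ≡ ∑ₑ H (λ e → f e * x)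
  *-distribʳ-∑ₑ x f = *-distribʳ-sum x (λ t → f (List.lookup (edges H) t))

  ∑ₑ-const : ∀ x → ∑ₑ H (λ _ → x) ≡ length (edges H) * x
  ∑ₑ-const = ∑-const (length (edges H))

  ∑ₑ-uniform : ∀ {r} → Uniform r H → (f : Subset n → ℕ → ℕ) → ∑ₑ H (λ e → f e ∣ e ∣) ≡ ∑ₑ H (λ e → f e r)
  ∑ₑ-uniform uniform f = sum-cong-≗ (λ t → cong (f (List.lookup (edges H) t)) (All.lookup uniform (∈-lookup t)))

utility≡∑ₑ : ∀ {n k} (H : Hypergraph n) (c : Coloring n k) v →
             utility H c v ≡ ∑ₑ H (λ e → [ v ∈? e ] * [ sameColour c v e ≡0])
utility≡∑ₑ H c v =
  trans (length-filter≡sum gains? (edges H)) (trans (sum-map-lookup (λ e → [ gains? e ]) (edges H)) (∑ₑ-cong H [gains?]))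
  where
  gains? : ∀ e → Dec (v ∈ e × ∣ colors c e ∣ ≡ suc ∣ colors c (remove v e) ∣)
  gains? e = (v ∈? e) ×-dec (∣ colors c e ∣ ≟ℕ suc ∣ colors c (remove v e) ∣)
  [gains?] : ∀ e → [ gains? e ] ≡ [ v ∈? e ] * [ sameColour c v e ≡0]
  [gains?] e = trans ([]-×-dec (v ∈? e) (∣ colors c e ∣ ≟ℕ suc ∣ colors c (remove v e) ∣))
                     ([]*-cong (v ∈? e) ([∣colors∣≟suc] c))

utility-recolor : ∀ {n k} (H : Hypergraph n) (c : Coloring n k) v i →
                  utility H (recolor c v i) v ≡ ∑ₑ H (λ e → [ v ∈? e ] * [ count c (remove v e) i ≡0])
utility-recolor H c v i = trans (utility≡∑ₑ H (recolor c v i) v) (∑ₑ-cong H sameColour-recolor)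
  where
  sameColour-recolor : ∀ e → [ v ∈? e ] * [ sameColour (recolor c v i) v e ≡0]
                           ≡ [ v ∈? e ] * [ count c (remove v e) i ≡0]
  sameColour-recolor e = cong (λ x → [ v ∈? e ] * [ x ≡0])
    (trans (cong (count (recolor c v i) (remove v e)) (recolor-self c v i)) (count-recolor-remove c v i e i))

uniques repeats residualColours : ∀ {n k} → Coloring n k → Subset n → ℕ
uniques         {n} c e = ∑[ v < n ] ([ v ∈? e ] * [ sameColour c v e ≡0])
repeats         {n} c e = ∑[ v < n ] ([ v ∈? e ] * [ sameColour c v e >0])
residualColours {n} c e = ∑[ v < n ] ([ v ∈? e ] * ∣ colors c (remove v e) ∣)

jEdge≡repeats : ∀ {n k} (c : Coloring n k) e → jEdge c e ≡ repeats c e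
jEdge≡repeats {n} c e =
  trans (length-filter≡sum repeated? (allFin n)) (trans (sum-map-tabulate (λ v → [ repeated? v ]) (λ v → v))
    (sum-cong-≗ λ v → trans ([]-×-dec (v ∈? e) (colors-unchanged? v)) ([]*-cong (v ∈? e) ([colors-remove≟colors] c))))
  where
  colors-unchanged? : ∀ v → Dec (colors c (remove v e) ≡ colors c e)
  colors-unchanged? v = ≡-dec _≟B_ (colors c (remove v e)) (colors c e)
  repeated? : ∀ v → Dec (v ∈ e × colors c (remove v e) ≡ colors c e)
  repeated? v = (v ∈? e) ×-dec colors-unchanged? v

uniques+repeats : ∀ {n k} (c : Coloring n k) e → uniques c e + repeats c e ≡ ∣ e ∣
uniques+repeats {n} c e = begin
  uniques c e + repeats c e
    ≡⟨ ∑-distrib-+ (λ v → [ v ∈? e ] * [ sameColour c v e ≡0]) (λ v → [ v ∈? e ] * [ sameColour c v e >0]) ⟨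
  ∑[ v < n ] ([ v ∈? e ] * [ sameColour c v e ≡0] + [ v ∈? e ] * [ sameColour c v e >0])
    ≡⟨ sum-cong-≗ (λ v → *-distribˡ-+ [ v ∈? e ] [ sameColour c v e ≡0] [ sameColour c v e >0]) ⟨
  ∑[ v < n ] ([ v ∈? e ] * ([ sameColour c v e ≡0] + [ sameColour c v e >0]))
    ≡⟨ sum-cong-≗ (λ v → trans (cong (_*_ [ v ∈? e ]) ([≡0]+[>0] (sameColour c v e))) (*-identityʳ [ v ∈? e ])) ⟩
  ∑[ v < n ] [ v ∈? e ]
    ≡⟨ ∣∣≡∑∈ e ⟨
  ∣ e ∣
    ∎
  where open ≡-Reasoning

residualColours+uniques : ∀ {n k} (c : Coloring n k) e → residualColours c e + uniques c e ≡ ∣ colors c e ∣ * ∣ e ∣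
residualColours+uniques {n} c e = begin
  residualColours c e + uniques c e
    ≡⟨ ∑-distrib-+ (λ v → [ v ∈? e ] * ∣ colors c (remove v e) ∣) (λ v → [ v ∈? e ] * [ sameColour c v e ≡0]) ⟨
  ∑[ v < n ] ([ v ∈? e ] * ∣ colors c (remove v e) ∣ + [ v ∈? e ] * [ sameColour c v e ≡0])
    ≡⟨ sum-cong-≗ (λ v → *-distribˡ-+ [ v ∈? e ] ∣ colors c (remove v e) ∣ [ sameColour c v e ≡0]) ⟨
  ∑[ v < n ] ([ v ∈? e ] * (∣ colors c (remove v e) ∣ + [ sameColour c v e ≡0]))
    ≡⟨ sum-cong-≗ (λ v → []*-cong (v ∈? e) (λ v∈e → ∣colors∣-remove c v∈e)) ⟨
  ∑[ v < n ] ([ v ∈? e ] * ∣ colors c e ∣)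
    ≡⟨ sum-cong-≗ (λ v → *-comm [ v ∈? e ] ∣ colors c e ∣) ⟩
  ∑[ v < n ] (∣ colors c e ∣ * [ v ∈? e ])
    ≡⟨ *-distribˡ-sum ∣ colors c e ∣ (λ v → [ v ∈? e ]) ⟨
  ∣ colors c e ∣ * ∑[ v < n ] [ v ∈? e ]
    ≡⟨ cong (_*_ ∣ colors c e ∣) (∣∣≡∑∈ e) ⟨
  ∣ colors c e ∣ * ∣ e ∣
    ∎
  where open ≡-Reasoning

2*[>0]≤ : ∀ m → 2 * [ m >0] ≤ m * 1 + m * [ pred m ≡0]
2*[>0]≤ 0             = z≤n
2*[>0]≤ 1             = ≤-refl
2*[>0]≤ (suc (suc m)) = s≤s (s≤s z≤n)

-- Grouping the vertices of e by colour, a class of size m contributes one colour and m vertices,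
-- all of them uniquely coloured iff m = 1.
2*∣colors∣≤ : ∀ {n k} (c : Coloring n k) e → 2 * ∣ colors c e ∣ ≤ ∣ e ∣ + uniques c e
2*∣colors∣≤ {n} {k} c e = begin
  2 * ∣ colors c e ∣                                      ≡⟨ cong (_*_ 2) (∣colors∣ c e) ⟩
  2 * ∑[ i < k ] [ m i >0]                                ≡⟨ *-distribˡ-sum 2 (λ i → [ m i >0]) ⟩
  ∑[ i < k ] (2 * [ m i >0])                              ≤⟨ ∑-mono-≤ (λ i → 2*[>0]≤ (m i)) ⟩
  ∑[ i < k ] (m i * 1 + m i * [ pred (m i) ≡0])           ≡⟨ ∑-distrib-+ (λ i → m i * 1) (λ i → m i * [ pred (m i) ≡0]) ⟩
  ∑[ i < k ] (m i * 1) + ∑[ i < k ] (m i * [ pred (m i) ≡0])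
    ≡⟨ cong₂ _+_ (∑-fibres c (λ v → [ v ∈? e ]) (λ _ → 1)) (∑-fibres c (λ v → [ v ∈? e ]) (λ i → [ pred (m i) ≡0])) ⟨
  ∑[ v < n ] ([ v ∈? e ] * 1) + ∑[ v < n ] ([ v ∈? e ] * [ pred (m (c v)) ≡0])
    ≡⟨ cong₂ _+_ (sum-cong-≗ (λ v → *-identityʳ [ v ∈? e ])) (sum-cong-≗ pred-count-own-colour) ⟩
  ∑[ v < n ] [ v ∈? e ] + uniques c e                     ≡⟨ cong (_+ uniques c e) (∣∣≡∑∈ e) ⟨
  ∣ e ∣ + uniques c e                                     ∎
  where
  open ≤-Reasoning
  m : Fin k → ℕ
  m = count c e
  pred-count-own-colour : ∀ v → [ v ∈? e ] * [ pred (m (c v)) ≡0] ≡ [ v ∈? e ] * [ sameColour c v e ≡0]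
  pred-count-own-colour v = []*-cong (v ∈? e) (λ v∈e → cong (λ x → [ pred x ≡0]) (count-own-colour c v∈e))

∑∑≤* : ∀ {m k} (h : Fin k → Fin m → ℕ) u → (∀ i → ∑[ t < m ] h i t ≤ u) → ∑[ t < m ] ∑[ i < k ] h i t ≤ k * u
∑∑≤* {m} {k} h u h≤u = begin
  ∑[ t < m ] ∑[ i < k ] h i t  ≡⟨ ∑-comm (λ t i → h i t) ⟩
  ∑[ i < k ] ∑[ t < m ] h i t  ≤⟨ ∑-mono-≤ h≤u ⟩
  ∑[ i < k ] u                 ≡⟨ ∑-const k u ⟩
  k * u                        ∎
  where open ≤-Reasoning

*-split-indicator : ∀ g k x y → x + y ≡ 1 → g * k ≡ k * (g * x + g * y)
*-split-indicator g k x y x+y≡1 = begin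
  g * k                ≡⟨ *-comm g k ⟩
  k * g                ≡⟨ cong (_*_ k) (*-identityʳ g) ⟨
  k * (g * 1)          ≡⟨ cong (λ z → k * (g * z)) x+y≡1 ⟨
  k * (g * (x + y))    ≡⟨ cong (_*_ k) (*-distribˡ-+ g x y) ⟩
  k * (g * x + g * y)  ∎
  where open ≡-Reasoning

-- Summing the Nash condition over all k deviations, each edge e ∋ v contributes the number of
-- colours absent from e∖{v}, which is k − |c(e∖{v})|.
nash-vertex : ∀ {n k} (H : Hypergraph n) (c : Coloring n k) → NashEquilibrium H c → ∀ v →
              k * ∑ₑ H (λ e → [ v ∈? e ] * [ sameColour c v e >0]) ≤ ∑ₑ H (λ e → [ v ∈? e ] * ∣ colors c (remove v e) ∣)
nash-vertex {k = k} H c nash v = +-cancelˡ-≤ (k * ∑ₑ H gain) (k * ∑ₑ H share) (∑ₑ H present) (begin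
  k * ∑ₑ H gain + k * ∑ₑ H share   ≡⟨ *-distribˡ-+ k (∑ₑ H gain) (∑ₑ H share) ⟨
  k * (∑ₑ H gain + ∑ₑ H share)     ≡⟨ absent+present≡k*[gain+share] ⟨
  ∑ₑ H absent + ∑ₑ H present       ≤⟨ +-monoˡ-≤ (∑ₑ H present) ∑absent≤k*∑gain ⟩
  k * ∑ₑ H gain + ∑ₑ H present     ∎)
  where
  open ≤-Reasoning
  gain share present absent : Subset _ → ℕ
  gain    e = [ v ∈? e ] * [ sameColour c v e ≡0]
  share   e = [ v ∈? e ] * [ sameColour c v e >0]
  present e = [ v ∈? e ] * ∣ colors c (remove v e) ∣
  absent  e = [ v ∈? e ] * ∑[ i < k ] [ count c (remove v e) i ≡0]

  no-profitable-deviation : ∀ i → ∑ₑ H (λ e → [ v ∈? e ] * [ count c (remove v e) i ≡0]) ≤ ∑ₑ H gain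
  no-profitable-deviation i = subst₂ _≤_ (utility-recolor H c v i) (utility≡∑ₑ H c v) (≮⇒≥ (nash v i))

  ∑absent≤k*∑gain : ∑ₑ H absent ≤ k * ∑ₑ H gain
  ∑absent≤k*∑gain = subst (_≤ k * ∑ₑ H gain)
    (∑ₑ-cong H (λ e → sym (*-distribˡ-sum [ v ∈? e ] (λ i → [ count c (remove v e) i ≡0]))))
    (∑∑≤* (λ i t → [ v ∈? _ ] * [ count c (remove v (List.lookup (edges H) t)) i ≡0]) (∑ₑ H gain) no-profitable-deviation)

  absent+present : ∀ e → absent e + present e ≡ k * (gain e + share e)
  absent+present e = begin-equality
    absent e + present e
      ≡⟨ *-distribˡ-+ [ v ∈? e ] _ ∣ colors c (remove v e) ∣ ⟨
    [ v ∈? e ] * (∑[ i < k ] [ count c (remove v e) i ≡0] + ∣ colors c (remove v e) ∣)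
      ≡⟨ cong (_*_ [ v ∈? e ]) (absent+∣colors∣ c (remove v e)) ⟩
    [ v ∈? e ] * k
      ≡⟨ *-split-indicator [ v ∈? e ] k _ _ ([≡0]+[>0] (sameColour c v e)) ⟩
    k * (gain e + share e)
      ∎

  absent+present≡k*[gain+share] : ∑ₑ H absent + ∑ₑ H present ≡ k * (∑ₑ H gain + ∑ₑ H share)
  absent+present≡k*[gain+share] = begin-equality
    ∑ₑ H absent + ∑ₑ H present               ≡⟨ ∑ₑ-distrib-+ H absent present ⟨
    ∑ₑ H (λ e → absent e + present e)        ≡⟨ ∑ₑ-cong H absent+present ⟩
    ∑ₑ H (λ e → k * (gain e + share e))      ≡⟨ *-distribˡ-∑ₑ H k (λ e → gain e + share e) ⟨
    k * ∑ₑ H (λ e → gain e + share e)        ≡⟨ cong (_*_ k) (∑ₑ-distrib-+ H gain share) ⟩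
    k * (∑ₑ H gain + ∑ₑ H share)             ∎

module _ {n k} (H : Hypergraph n) (c : Coloring n k) where

  SW≡∑ₑuniques : SW H c ≡ ∑ₑ H (uniques c)
  SW≡∑ₑuniques = begin
    SW H c                                                          ≡⟨ sum-map-tabulate (utility H c) (λ v → v) ⟩
    ∑[ v < n ] utility H c v                                        ≡⟨ sum-cong-≗ (utility≡∑ₑ H c) ⟩
    ∑[ v < n ] ∑ₑ H (λ e → [ v ∈? e ] * [ sameColour c v e ≡0])    ≡⟨ ∑-comm (λ v t → gain v (List.lookup (edges H) t)) ⟩
    ∑ₑ H (uniques c)                                                ∎
    where
    open ≡-Reasoning
    gain : Fin n → Subset n → ℕ
    gain v e = [ v ∈? e ] * [ sameColour c v e ≡0]

  jHat≡∑ₑrepeats : jHat H c ≡ ∑ₑ H (repeats c)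
  jHat≡∑ₑrepeats = trans (sum-map-lookup (jEdge c) (edges H)) (∑ₑ-cong H (jEdge≡repeats c))

  nash-k*jHat≤ : NashEquilibrium H c → k * jHat H c ≤ ∑ₑ H (residualColours c)
  nash-k*jHat≤ nash = begin
    k * jHat H c                       ≡⟨ cong (_*_ k) jHat≡∑ₑrepeats ⟩
    k * ∑ₑ H (repeats c)               ≡⟨ cong (_*_ k) (∑-comm (λ t v → share v (List.lookup (edges H) t))) ⟩
    k * ∑[ v < n ] ∑ₑ H (share v)      ≡⟨ *-distribˡ-sum k (λ v → ∑ₑ H (share v)) ⟩
    ∑[ v < n ] (k * ∑ₑ H (share v))    ≤⟨ ∑-mono-≤ (nash-vertex H c nash) ⟩
    ∑[ v < n ] ∑ₑ H (present v)        ≡⟨ ∑-comm (λ v t → present v (List.lookup (edges H) t)) ⟩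
    ∑ₑ H (residualColours c)           ∎
    where
    open ≤-Reasoning
    share present : Fin n → Subset n → ℕ
    share   v e = [ v ∈? e ] * [ sameColour c v e >0]
    present v e = [ v ∈? e ] * ∣ colors c (remove v e) ∣

module _ {n k r} (H : Hypergraph n) (c : Coloring n k) (uniform : Uniform r H) where

  ∑ₑresidualColours+SW : ∑ₑ H (residualColours c) + SW H c ≡ ∑ₑ H (λ e → ∣ colors c e ∣) * r
  ∑ₑresidualColours+SW = begin
    ∑ₑ H (residualColours c) + SW H c                ≡⟨ cong (_+_ (∑ₑ H (residualColours c))) (SW≡∑ₑuniques H c) ⟩
    ∑ₑ H (residualColours c) + ∑ₑ H (uniques c)      ≡⟨ ∑ₑ-distrib-+ H (residualColours c) (uniques c) ⟨
    ∑ₑ H (λ e → residualColours c e + uniques c e)   ≡⟨ ∑ₑ-cong H (residualColours+uniques c) ⟩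
    ∑ₑ H (λ e → ∣ colors c e ∣ * ∣ e ∣)              ≡⟨ ∑ₑ-uniform H uniform (λ e s → ∣ colors c e ∣ * s) ⟩
    ∑ₑ H (λ e → ∣ colors c e ∣ * r)                  ≡⟨ *-distribʳ-∑ₑ H r (λ e → ∣ colors c e ∣) ⟨
    ∑ₑ H (λ e → ∣ colors c e ∣) * r                  ∎
    where open ≡-Reasoning

  ∑ₑ∣∣ : ∑ₑ H ∣_∣ ≡ length (edges H) * r
  ∑ₑ∣∣ = trans (∑ₑ-uniform H uniform (λ _ s → s)) (∑ₑ-const H r)

  SW+jHat : SW H c + jHat H c ≡ length (edges H) * r
  SW+jHat = begin
    SW H c + jHat H c                          ≡⟨ cong₂ _+_ (SW≡∑ₑuniques H c) (jHat≡∑ₑrepeats H c) ⟩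
    ∑ₑ H (uniques c) + ∑ₑ H (repeats c)        ≡⟨ ∑ₑ-distrib-+ H (uniques c) (repeats c) ⟨
    ∑ₑ H (λ e → uniques c e + repeats c e)     ≡⟨ ∑ₑ-cong H (uniques+repeats c) ⟩
    ∑ₑ H ∣_∣                                   ≡⟨ ∑ₑ∣∣ ⟩
    length (edges H) * r                       ∎
    where open ≡-Reasoning

  2*∑ₑ∣colors∣≤ : 2 * ∑ₑ H (λ e → ∣ colors c e ∣) ≤ length (edges H) * r + SW H c
  2*∑ₑ∣colors∣≤ = begin
    2 * ∑ₑ H (λ e → ∣ colors c e ∣)             ≡⟨ *-distribˡ-∑ₑ H 2 (λ e → ∣ colors c e ∣) ⟩
    ∑ₑ H (λ e → 2 * ∣ colors c e ∣)             ≤⟨ ∑ₑ-mono-≤ H (2*∣colors∣≤ c) ⟩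
    ∑ₑ H (λ e → ∣ e ∣ + uniques c e)            ≡⟨ ∑ₑ-distrib-+ H ∣_∣ (uniques c) ⟩
    ∑ₑ H ∣_∣ + ∑ₑ H (uniques c)                 ≡⟨ cong₂ _+_ ∑ₑ∣∣ (sym (SW≡∑ₑuniques H c)) ⟩
    length (edges H) * r + SW H c               ∎
    where open ≤-Reasoning

jHat-bound : ∀ r₂ k E C S U J → S + U ≡ C * (2 + r₂) → U + J ≡ E * (2 + r₂) →
             2 * C ≤ E * (2 + r₂) + U → k * J ≤ S → J * (r₂ + 2 * k) ≤ 2 * (E * (2 + r₂) * (1 + r₂))
jHat-bound r₂ k E C S U J S+U≡ U+J≡ 2C≤ kJ≤S = +-cancelʳ-≤ (2 * U) _ _ (begin
  J * (r₂ + 2 * k) + 2 * U                     ≡⟨ solve (J ∷ r₂ ∷ k ∷ U ∷ []) ⟩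
  2 * (k * J) + r₂ * J + 2 * U                 ≤⟨ +-monoˡ-≤ (2 * U) (+-monoˡ-≤ (r₂ * J) (*-monoʳ-≤ 2 kJ≤S)) ⟩
  2 * S + r₂ * J + 2 * U                       ≡⟨ solve (S ∷ r₂ ∷ J ∷ U ∷ []) ⟩
  2 * (S + U) + r₂ * J                         ≡⟨ cong (λ x → 2 * x + r₂ * J) S+U≡ ⟩
  2 * (C * (2 + r₂)) + r₂ * J                  ≡⟨ solve (C ∷ r₂ ∷ J ∷ []) ⟩
  2 * C * (2 + r₂) + r₂ * J                    ≤⟨ +-monoˡ-≤ (r₂ * J) (*-monoˡ-≤ (2 + r₂) 2C≤) ⟩
  (E * (2 + r₂) + U) * (2 + r₂) + r₂ * J       ≡⟨ solve (E ∷ r₂ ∷ U ∷ J ∷ []) ⟩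
  E * (2 + r₂) * (2 + r₂) + 2 * U + r₂ * (U + J)  ≡⟨ cong (λ x → E * (2 + r₂) * (2 + r₂) + 2 * U + r₂ * x) U+J≡ ⟩
  E * (2 + r₂) * (2 + r₂) + 2 * U + r₂ * (E * (2 + r₂))  ≡⟨ solve (E ∷ r₂ ∷ U ∷ []) ⟩
  2 * (E * (2 + r₂) * (1 + r₂)) + 2 * U        ∎)
  where open ≤-Reasoning

SW-bound : ∀ r₂ k E U J → U + J ≡ E * (2 + r₂) → J * (r₂ + 2 * k) ≤ 2 * (E * (2 + r₂) * (1 + r₂)) →
           E * (2 + r₂) * (2 * k) ≤ U * (r₂ + 2 * k) + E * (2 + r₂) * (2 + r₂)
SW-bound r₂ k E U J U+J≡ J[r₂+2k]≤ = +-cancelʳ-≤ (2 * (E * (2 + r₂) * (1 + r₂))) _ _ (begin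
  E * (2 + r₂) * (2 * k) + 2 * (E * (2 + r₂) * (1 + r₂))          ≡⟨ solve (E ∷ r₂ ∷ k ∷ []) ⟩
  E * (2 + r₂) * (r₂ + 2 * k) + E * (2 + r₂) * (2 + r₂)           ≡⟨ cong (λ x → x * (r₂ + 2 * k) + E * (2 + r₂) * (2 + r₂)) U+J≡ ⟨
  (U + J) * (r₂ + 2 * k) + E * (2 + r₂) * (2 + r₂)                ≡⟨ solve (U ∷ J ∷ r₂ ∷ k ∷ E ∷ []) ⟩
  U * (r₂ + 2 * k) + E * (2 + r₂) * (2 + r₂) + J * (r₂ + 2 * k)   ≤⟨ +-monoʳ-≤ _ J[r₂+2k]≤ ⟩
  U * (r₂ + 2 * k) + E * (2 + r₂) * (2 + r₂) + 2 * (E * (2 + r₂) * (1 + r₂))  ∎)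
  where open ≤-Reasoning

*[-]≤ : ∀ a b c x → a *ℤ b ≤ℤ x +ℤ a *ℤ c → a *ℤ (b -ℤ c) ≤ℤ x
*[-]≤ a b c x ab≤x+ac = begin
  a *ℤ (b -ℤ c)                ≡⟨ ℤ.solve (a ∷ b ∷ c ∷ []) ⟩
  a *ℤ b -ℤ a *ℤ c             ≤⟨ ℤ.+-monoˡ-≤ (ℤ.- (a *ℤ c)) ab≤x+ac ⟩
  x +ℤ a *ℤ c -ℤ a *ℤ c        ≡⟨ ℤ.solve (x ∷ a ∷ c ∷ []) ⟩
  x                            ∎
  where open ℤ.≤-Reasoning

+*[+-+]≤+ : ∀ a b c x → a * b ≤ x + a * c → + a *ℤ (+ b -ℤ + c) ≤ℤ + x
+*[+-+]≤+ a b c x ab≤x+ac = *[-]≤ (+ a) (+ b) (+ c) (+ x)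
  (subst₂ _≤ℤ_ (ℤ.pos-* a b) (trans (ℤ.pos-+ x (a * c)) (cong (_+ℤ_ (+ x)) (ℤ.pos-* a c))) (ℤ.+≤+ ab≤x+ac))

2k+[2+r₂]∸2 : ∀ k r₂ → 2 * k + (2 + r₂) ∸ 2 ≡ r₂ + 2 * k
2k+[2+r₂]∸2 k r₂ = cong (_∸ 2) (+-comm (2 * k) (2 + r₂))

lemma3 : (n r k : ℕ) → 2 ≤ r → 2 ≤ k → (H : Hypergraph n) → Uniform r H →
         (c : Coloring n k) → NashEquilibrium H c →
         (jHat H c * (r + 2 * k ∸ 2) ≤ 2 * (length (edges H) * r * (r ∸ 1)))
         ×
         ((+ (length (edges H) * r)) *ℤ ((+ (2 * k)) -ℤ (+ r))
            ≤ℤ (+ SW H c) *ℤ (+ (2 * k + r ∸ 2)))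
lemma3 n (suc (suc r₂)) k (s≤s (s≤s z≤n)) _ H uniform c nash = jHat≤ , SW≥
  where
  E : ℕ
  E = length (edges H)
  jHat≤ : jHat H c * (r₂ + 2 * k) ≤ 2 * (E * (2 + r₂) * (1 + r₂))
  jHat≤ = jHat-bound r₂ k E (∑ₑ H (λ e → ∣ colors c e ∣)) (∑ₑ H (residualColours c)) (SW H c) (jHat H c)
    (∑ₑresidualColours+SW H c uniform) (SW+jHat H c uniform) (2*∑ₑ∣colors∣≤ H c uniform) (nash-k*jHat≤ H c nash)
  SW≥ : + (E * (2 + r₂)) *ℤ (+ (2 * k) -ℤ + (2 + r₂)) ≤ℤ + SW H c *ℤ + (2 * k + (2 + r₂) ∸ 2)
  SW≥ = subst (+ (E * (2 + r₂)) *ℤ (+ (2 * k) -ℤ + (2 + r₂)) ≤ℤ_)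
    (trans (cong (λ d → + (SW H c * d)) (sym (2k+[2+r₂]∸2 k r₂))) (ℤ.pos-* (SW H c) _))
    (+*[+-+]≤+ (E * (2 + r₂)) (2 * k) (2 + r₂) (SW H c * (r₂ + 2 * k))
      (SW-bound r₂ k E (SW H c) (jHat H c) (SW+jHat H c uniform) jHat≤))
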